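{- If $(\mathcal G,z,x,\psi)$ is a tall tame critical easel, then $\mathcal G-z$ is 2-connected.
   Context: Graphs are finite, loopless, may have parallel edges. A $\mathbb{Z}_3$-boundary of $G$ is $\beta:V(G)\to\mathbb{Z}_3$ summing to $0$ over every component; $\mathcal G=(G,\beta)$ is a $\mathbb{Z}_3$-bordered graph. A nowhere-zero flow is an orientation with $\deg^+(v)-\deg^-(v)\equiv\beta(v)\pmod 3$ for every $v$. For a vertex $v$, $|\tau(v)|$ is $0$ if $\deg(v)$ even and $\beta(v)=0$; $2$ if $\deg(v)$ even and $\beta(v)\ne0$; $3$ if $\deg(v)$ odd and $\beta(v)=0$; $1$ if $\deg(v)$ odd and $\beta(v)\ne0$. For a partition $\mathcal P$ of $V(G)$, $\mathcal G/\mathcal P$ identifies each part into one vertex, deletes loops and sums $\beta$ over parts; $\mathcal P$ is non-trivial if some part has $\ge2$ vertices. A canvas $(\mathcal G,z)$ is a $\mathbb{Z}_3$-bordered graph with tip $z$. A tip preflow is an orientation $\psi$ of the edges at $z$ with (in $\psi$) $\deg^+(z)-\deg^-(z)\equiv\beta(z)\pmod 3$; it extends if some nowhere-zero flow agrees with it at $z$. $\mathcal P$ is tip-respecting if $\{z\}$ is a part. The canvas is $\psi$-critical if $\psi$ does not extend in $\mathcal G$ but extends in $\mathcal G/\mathcal P$ for every non-trivial tip-respecting $\mathcal P$. An easel is $(\mathcal G,z,x,\psi)$ with $(\mathcal G,z)$ a canvas, $x\ne z$ a vertex, $\psi$ a tip preflow; it is tame if $\deg(v)\ge4+|\tau(v)|$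 for all $v\notin\{x,z\}$; tall if $\deg(z)\le\deg(x)+2$ and, when $\deg(z)=\deg(x)+2$, $\psi$ directs some edge incident with $z$ but not $x$ towards $z$ and another such edge away from $z$; critical if $(\mathcal G,z)$ is $\psi$-critical. -}

module Defs where

open import Data.Nat as ℕ using (ℕ; zero; suc; _≤_; _%_)
open import Data.Nat.Divisibility as ℕD using ()
open import Data.Integer as ℤ using (ℤ; +_; _-_)
open import Data.Integer.Divisibility as ℤD using ()
open import Data.Fin using (Fin; _≟_)
open import Data.Fin.Properties using ()
open import Data.Bool using (Bool; true; false; if_then_else_; _∧_; _∨_; not)
open import Data.Product using (Σ; ∃; ∃-syntax; _×_; _,_; proj₁; proj₂)
open import Data.Sum using (_⊎_)
open import Relation.Nullary using (¬_; does)
open import Relation.Binary.PropositionalEquality using (_≡_; _≢_)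
open import Function using (_∘_; _⇔_)

-- Z₃ is represented by integers taken modulo 3.

infix 4 _≡₃_
_≡₃_ : ℤ → ℤ → Set
a ≡₃ b = (+ 3) ℤD.∣ (a - b)

isZero₃ : ℤ → Bool
isZero₃ a = does (3 ℕD.∣? ℤ.∣ a ∣)

count : ∀ {m} → (Fin m → Bool) → ℕ
count {zero}  f = 0
count {suc m} f = (if f Data.Fin.zero then 1 else 0) ℕ.+ count (f ∘ Data.Fin.suc)

sumℤ : ∀ {n} → (Fin n → ℤ) → ℤ
sumℤ {zero}  f = + 0
sumℤ {suc n} f = f Data.Fin.zero ℤ.+ sumℤ (f ∘ Data.Fin.suc)

-- Multigraphs: n vertices (Fin n), m edges (Fin m), each edge has an
-- ordered pair of ends (used as the reference direction of the edge).

Graph : ℕ → ℕ → Set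
Graph n m = Fin m → Fin n × Fin n

module _ {n m : ℕ} (G : Graph n m) where

  Loopless : Set
  Loopless = ∀ e → proj₁ (G e) ≢ proj₂ (G e)

  _=ᵇ_ : Fin n → Fin n → Bool
  u =ᵇ v = does (u ≟ v)

  incᵇ : Fin m → Fin n → Bool
  incᵇ e v = not (proj₁ (G e) =ᵇ proj₂ (G e))
             ∧ ((proj₁ (G e) =ᵇ v) ∨ (proj₂ (G e) =ᵇ v))

  Incident : Fin m → Fin n → Set
  Incident e v = incᵇ e v ≡ true

  -- degree (loops, if any, are ignored, i.e. deleted)
  deg : Fin n → ℕ
  deg v = count (λ e → incᵇ e v)

  -- An orientation assigns to each edge a Bool:
  -- true  = directed from proj₁ to proj₂,  false = from proj₂ to proj₁.
  Orientation : Set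
  Orientation = Fin m → Bool

  tail head : Orientation → Fin m → Fin n
  tail o e = if o e then proj₁ (G e) else proj₂ (G e)
  head o e = if o e then proj₂ (G e) else proj₁ (G e)

  outdeg indeg : Orientation → Fin n → ℕ
  outdeg o v = count (λ e → incᵇ e v ∧ (tail o e =ᵇ v))
  indeg  o v = count (λ e → incᵇ e v ∧ (head o e =ᵇ v))

  netOut : Orientation → Fin n → ℤ
  netOut o v = (+ outdeg o v) - (+ indeg o v)

  IsNZFlow : (Fin n → ℤ) → Orientation → Set
  IsNZFlow β o = ∀ v → netOut o v ≡₃ β v

  Adj : Fin n → Fin n → Set
  Adj u v = ∃[ e ] (incᵇ e u ≡ true × incᵇ e v ≡ true × u ≢ v)

  data WalkIn (S : Fin n → Set) : Fin n → Fin n → Set where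
    here : ∀ {u} → S u → WalkIn S u u
    step : ∀ {u v w} → S u → Adj u v → WalkIn S v w → WalkIn S u w

  Everything : Fin n → Set
  Everything _ = Fin n

  -- Z₃-boundary: β sums to 0 (mod 3) over every component.
  -- The component of v is the set C of vertices reachable from v.
  IsBoundary : (Fin n → ℤ) → Set
  IsBoundary β = ∀ (v : Fin n) (C : Fin n → Bool) →
    (∀ w → (C w ≡ true) ⇔ WalkIn Everything v w) →
    sumℤ (λ w → if C w then β w else + 0) ≡₃ (+ 0)

  tauAbs : (Fin n → ℤ) → Fin n → ℕ
  tauAbs β v with deg v % 2 | isZero₃ (β v)
  ... | zero  | true  = 0
  ... | zero  | false = 2
  ... | suc _ | true  = 3
  ... | suc _ | false = 1

  -- Tip preflow at z: only the values of ψ on edges incident with z matter.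
  IsTipPreflow : (Fin n → ℤ) → Fin n → Orientation → Set
  IsTipPreflow β z ψ = netOut ψ z ≡₃ β z

  Extends : (Fin n → ℤ) → Fin n → Orientation → Set
  Extends β z ψ = Σ Orientation λ o →
    IsNZFlow β o × (∀ e → Incident e z → o e ≡ ψ e)

  ConnectedOn : (Fin n → Set) → Set
  ConnectedOn S = ∀ u v → S u → S v → WalkIn S u v

  -- 2-connected (Diestel): more than 2 vertices and G[S] - X connected
  -- for every X ⊆ S with |X| < 2.
  TwoConnectedOn : (Fin n → Set) → Set
  TwoConnectedOn S =
    (∃[ a ] ∃[ b ] ∃[ c ] (S a × S b × S c × a ≢ b × a ≢ c × b ≢ c))
    × ConnectedOn S
    × (∀ w → S w → ConnectedOn (λ v → S v × v ≢ w))

-- Partitions of Fin n into k (non-empty) parts: surjections p : Fin n → Fin k.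

Surjective : ∀ {n k} → (Fin n → Fin k) → Set
Surjective {n} {k} p = ∀ (j : Fin k) → ∃[ v ] (p v ≡ j)

NonTrivial : ∀ {n k} → (Fin n → Fin k) → Set
NonTrivial p = ∃[ u ] ∃[ v ] (u ≢ v × p u ≡ p v)

TipRespecting : ∀ {n k} → (Fin n → Fin k) → Fin n → Set
TipRespecting p z = ∀ v → p v ≡ p z → v ≡ z

-- G/P: identify each part; edges becoming loops are ignored by all the
-- degree counts above (i.e. they are deleted).
quotG : ∀ {n m k} → Graph n m → (Fin n → Fin k) → Graph k m
quotG G p e = p (proj₁ (G e)) , p (proj₂ (G e))

quotβ : ∀ {n k} → (Fin n → ℤ) → (Fin n → Fin k) → Fin k → ℤ
quotβ β p j = sumℤ (λ v → if does (p v ≟ j) then β v else + 0)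

IsCritical : ∀ {n m} → Graph n m → (Fin n → ℤ) → Fin n → (Fin m → Bool) → Set
IsCritical {n} {m} G β z ψ =
  ¬ Extends G β z ψ ×
  (∀ (k : ℕ) (p : Fin n → Fin k) → Surjective p → NonTrivial p → TipRespecting p z →
     Extends (quotG G p) (quotβ β p) (p z) ψ)

module _ {n m : ℕ} (G : Graph n m) (β : Fin n → ℤ) (z x : Fin n) (ψ : Fin m → Bool) where

  Tame : Set
  Tame = ∀ v → v ≢ x → v ≢ z → 4 ℕ.+ tauAbs G β v ≤ deg G v

  Tall : Set
  Tall = deg G z ≤ deg G x ℕ.+ 2 ×
         (deg G z ≡ deg G x ℕ.+ 2 →
           ∃[ e₁ ] ∃[ e₂ ]
             (Incident G e₁ z × ¬ Incident G e₁ x × head G ψ e₁ ≡ z ×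
              Incident G e₂ z × ¬ Incident G e₂ x × tail G ψ e₂ ≡ z))

{-# OPTIONS --safe #-}
module Submission where

-- Let c ≠ z, and let A be a set of vertices of G − z − c with no edge to the
-- rest R of G − z − c, with a ∈ A and b ∈ R. Criticality gives flows of
-- G/{c, b} and of G/{c, a} extending ψ; as orientations of G they are valid off
-- {b, c} and off {a, c}. Using the first on the edges touching A and the second
-- elsewhere gives an orientation valid everywhere except possibly at c, and since
-- net outflows and β both sum to 0 over the component of c, also at c: ψ would
-- extend. A disconnection of G − z − c, or of G − z (with c a suitable vertex),
-- yields such an A. Tallness and tameness are needed only to show that G − z has
-- a vertex besides x and y: otherwise two x–y edges can give y any residue, and
-- with at most one the degree bounds force deg y = 4, β(y) = 0 and z–y edges into
-- and out of y, so the direction of the x–y edge can balance y.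

open import Defs
open import Data.Nat as ℕ using (ℕ; zero; suc; _≤_; _<_; z≤n; s≤s; _%_)
import Data.Nat.Properties as ℕP
import Data.Nat.Divisibility as ℕD
open import Data.Integer as ℤ using (ℤ; +_; -[1+_]; _+_; _-_; -_; _*_; -1ℤ)
import Data.Integer.Properties as ℤP
open import Data.Integer.DivMod using (_%ℕ_; _/ℕ_; n%ℕd<d; a≡a%ℕn+[a/ℕn]*n)
open import Data.Integer.Divisibility.Signed
  using (_∣_; divides; ∣ᵤ⇒∣; ∣⇒∣ᵤ; ∣m∣n⇒∣m+n; ∣m+n∣n⇒∣m; ∣m⇒∣-m)
open import Data.Integer.Tactic.RingSolver using (solve-∀)
open import Algebra.Properties.Semiring.Sum ℤP.+-*-semiring
  using (sum; sum-cong-≗; ∑-comm; ∑-distrib-+; *-distribˡ-sum; sum-remove; sum-replicate-zero)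
open import Data.Fin using (Fin; zero; suc; _≟_; punchIn; punchOut)
open import Data.Fin.Properties
  using (any?; suc-injective; punchInᵢ≢i; punchOut-cong; punchOut-injective; punchOut-punchIn)
open import Data.Bool using (Bool; true; false; if_then_else_; _∧_; _∨_; not)
import Data.Bool.Properties as BoolP
open import Data.Product using (∃; ∃₂; ∃-syntax; _×_; _,_; proj₁; proj₂)
open import Data.Sum using (_⊎_; inj₁; inj₂)
open import Data.Empty using (⊥-elim)
open import Function using (_∘_; mk⇔)
open import Relation.Nullary using (¬_; Dec; yes; no; does; ¬?)
open import Relation.Nullary.Decidable using (dec-true; dec-false; _×-dec_)
open import Relation.Unary using (Decidable)
open import Relation.Binary.PropositionalEquality
  using (_≡_; _≢_; refl; sym; trans; cong; cong₂; subst; subst₂; module ≡-Reasoning)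

true≢false : true ≢ false
true≢false ()

∧-true-left : ∀ {x y} → x ∧ y ≡ true → x ≡ true
∧-true-left {true} _ = refl

≢-by : ∀ {A : Set} (f : A → Bool) {a b} → f a ≡ true → f b ≡ false → a ≢ b
≢-by f fa fb refl = true≢false (trans (sym fa) fb)

infix 4 _==_
_==_ : ∀ {n} → Fin n → Fin n → Bool
i == j = does (i ≟ j)

==-refl : ∀ {n} (i : Fin n) → (i == i) ≡ true
==-refl i = dec-true (i ≟ i) refl

≢⇒==-false : ∀ {n} {i j : Fin n} → i ≢ j → (i == j) ≡ false
≢⇒==-false {i = i} {j} = dec-false (i ≟ j)

==⇒≡ : ∀ {n} {i j : Fin n} → (i == j) ≡ true → i ≡ j
==⇒≡ {i = i} {j} i==j with i ≟ j
... | yes i≡j = i≡j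

select-end : ∀ {n} {a b v : Fin n} → a ≡ v ⊎ b ≡ v → (if does (a ≟ v) then a else b) ≡ v
select-end {a = a} {v = v} ends with a ≟ v | ends
... | yes a≡v | _        = a≡v
... | no a≢v  | inj₁ a≡v = ⊥-elim (a≢v a≡v)
... | no _    | inj₂ b≡v = b≡v

select-other-end : ∀ {n} {a b v : Fin n} → a ≡ v ⊎ b ≡ v → (if not (does (a ≟ v)) then b else a) ≡ v
select-other-end {a = a} {v = v} ends with a ≟ v | ends
... | yes a≡v | _        = a≡v
... | no a≢v  | inj₁ a≡v = ⊥-elim (a≢v a≡v)
... | no _    | inj₂ b≡v = b≡v

does⇒ : ∀ {P : Set} (P? : Dec P) → does P? ≡ true → P
does⇒ (yes p) _ = p

𝟙 : Bool → ℤ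
𝟙 true  = + 1
𝟙 false = + 0

indicator-mono : ∀ {x y : Bool} → (x ≡ true → y ≡ true) → (if x then 1 else 0) ≤ (if y then 1 else 0)
indicator-mono {false} _   = z≤n
indicator-mono {true}  x⇒y rewrite x⇒y refl = ℕP.≤-refl

count-cong : ∀ {m} {f g : Fin m → Bool} → (∀ i → f i ≡ g i) → count f ≡ count g
count-cong {zero}  _   = refl
count-cong {suc m} f≗g =
  cong₂ (λ b c → (if b then 1 else 0) ℕ.+ c) (f≗g zero) (count-cong (f≗g ∘ suc))

count-split : ∀ {m} (f g : Fin m → Bool) →
  count f ≡ count (λ i → f i ∧ g i) ℕ.+ count (λ i → f i ∧ not (g i))
count-split {zero}  f g = refl
count-split {suc m} f g with f zero | g zero
... | true  | true  = cong suc (count-split (f ∘ suc) (g ∘ suc))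
... | true  | false = trans (cong suc (count-split (f ∘ suc) (g ∘ suc))) (sym (ℕP.+-suc _ _))
... | false | _     = count-split (f ∘ suc) (g ∘ suc)

count-mono : ∀ {m} {f g : Fin m → Bool} → (∀ i → f i ≡ true → g i ≡ true) → count f ≤ count g
count-mono {zero}  _   = z≤n
count-mono {suc m} f⊆g = ℕP.+-mono-≤ (indicator-mono (f⊆g zero)) (count-mono (f⊆g ∘ suc))

count-< : ∀ {m} {f g : Fin m → Bool} → (∀ i → f i ≡ true → g i ≡ true) →
  ∀ {i} → f i ≡ false → g i ≡ true → count f < count g
count-< {suc m} f⊆g {zero} fi gi rewrite fi | gi = s≤s (count-mono (f⊆g ∘ suc))
count-< {suc m} f⊆g {suc i} fi gi =
  ℕP.+-mono-≤-< (indicator-mono (f⊆g zero)) (count-< (f⊆g ∘ suc) fi gi)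

count-pos : ∀ {m} (f : Fin m → Bool) {i} → f i ≡ true → 0 < count f
count-pos {suc m} f {zero}  fi rewrite fi = s≤s z≤n
count-pos {suc m} f {suc i} fi = ℕP.<-≤-trans (count-pos (f ∘ suc) fi) (ℕP.m≤n+m _ _)

count-exists : ∀ {m} {f : Fin m → Bool} → 0 < count f → ∃ λ i → f i ≡ true
count-exists {suc m} {f} pos with f zero in f0
... | true  = zero , f0
... | false = let i , fi = count-exists pos in suc i , fi

count-two : ∀ {m} {f : Fin m → Bool} → 1 < count f →
  ∃₂ λ i j → i ≢ j × f i ≡ true × f j ≡ true
count-two {suc m} {f} two with f zero in f0
... | true  = let j , fj = count-exists (ℕP.≤-pred two) in zero , suc j , (λ ()) , f0 , fj
... | false = let i , j , i≢j , fi , fj = count-two two in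
              suc i , suc j , i≢j ∘ suc-injective , fi , fj

count≤size : ∀ {m} (f : Fin m → Bool) → count f ≤ m
count≤size {zero}  f = z≤n
count≤size {suc m} f with f zero
... | true  = s≤s (count≤size (f ∘ suc))
... | false = ℕP.m≤n⇒m≤1+n (count≤size (f ∘ suc))

sumℤ≡sum : ∀ {n} (f : Fin n → ℤ) → sumℤ f ≡ sum f
sumℤ≡sum {zero}  f = refl
sumℤ≡sum {suc n} f = cong (_+_ (f zero)) (sumℤ≡sum (f ∘ suc))

count≡sum : ∀ {m} (f : Fin m → Bool) → + count f ≡ sum (𝟙 ∘ f)
count≡sum {zero}  f = refl
count≡sum {suc m} f with f zero
... | true  = trans (ℤP.pos-+ 1 (count (f ∘ suc))) (cong (_+_ (+ 1)) (count≡sum (f ∘ suc)))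
... | false = trans (count≡sum (f ∘ suc)) (sym (ℤP.+-identityˡ _))

sum-zero : ∀ {n} {f : Fin n → ℤ} → (∀ i → f i ≡ + 0) → sum f ≡ + 0
sum-zero {n} f≗0 = trans (sum-cong-≗ f≗0) (sum-replicate-zero n)

sum-neg : ∀ {n} (f : Fin n → ℤ) → sum (λ i → - f i) ≡ - sum f
sum-neg f = begin
  sum (λ i → - f i)      ≡⟨ sum-cong-≗ (λ i → sym (ℤP.-1*i≡-i (f i))) ⟩
  sum (λ i → -1ℤ * f i)  ≡⟨ sym (*-distribˡ-sum -1ℤ f) ⟩
  -1ℤ * sum f            ≡⟨ ℤP.-1*i≡-i (sum f) ⟩
  - sum f                ∎
  where open ≡-Reasoning

sum-sub : ∀ {n} (f g : Fin n → ℤ) → sum (λ i → f i - g i) ≡ sum f - sum g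
sum-sub f g = trans (∑-distrib-+ f (λ i → - g i)) (cong (_+_ (sum f)) (sum-neg g))

sum-single : ∀ {n} (f : Fin n → ℤ) i → (∀ j → j ≢ i → f j ≡ + 0) → sum f ≡ f i
sum-single {suc n} f i off = begin
  sum f                          ≡⟨ sum-remove {i = i} f ⟩
  f i + sum (f ∘ punchIn i)      ≡⟨ cong (_+_ (f i)) (sum-zero (λ j → off _ (punchInᵢ≢i i j))) ⟩
  f i + + 0                      ≡⟨ ℤP.+-identityʳ (f i) ⟩
  f i                            ∎
  where open ≡-Reasoning

sum-update : ∀ {n} (f g : Fin n → ℤ) i → (∀ j → j ≢ i → f j ≡ g j) → sum f + g i ≡ sum g + f i
sum-update {suc n} f g i agree = begin
  sum f + g i                          ≡⟨ cong (_+ g i) (sum-remove {i = i} f) ⟩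
  f i + sum (f ∘ punchIn i) + g i      ≡⟨ cong (λ s → f i + s + g i) rest ⟩
  f i + sum (g ∘ punchIn i) + g i      ≡⟨ swap (f i) (sum (g ∘ punchIn i)) (g i) ⟩
  g i + sum (g ∘ punchIn i) + f i      ≡⟨ cong (_+ f i) (sym (sum-remove {i = i} g)) ⟩
  sum g + f i                          ∎
  where
  open ≡-Reasoning
  rest : sum (f ∘ punchIn i) ≡ sum (g ∘ punchIn i)
  rest = sum-cong-≗ (λ j → agree _ (punchInᵢ≢i i j))
  swap : ∀ a s b → a + s + b ≡ b + s + a
  swap = solve-∀

sum-pair : ∀ {n} (f : Fin n → ℤ) {i j} → i ≢ j → (∀ k → k ≢ i → k ≢ j → f k ≡ + 0) →
  sum f ≡ f i + f j
sum-pair f {i} {j} i≢j off = begin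
  sum f                   ≡⟨ sym (ℤP.+-identityʳ (sum f)) ⟩
  sum f + + 0             ≡⟨ cong (_+_ (sum f)) (sym f₀-i) ⟩
  sum f + f₀ i            ≡⟨ sum-update f f₀ i (λ k k≢i → sym (f₀-off k≢i)) ⟩
  sum f₀ + f i            ≡⟨ cong (_+ f i) (sum-single f₀ j only-j) ⟩
  f₀ j + f i              ≡⟨ cong (_+ f i) (f₀-off (i≢j ∘ sym)) ⟩
  f j + f i               ≡⟨ ℤP.+-comm (f j) (f i) ⟩
  f i + f j               ∎
  where
  open ≡-Reasoning
  f₀ : Fin _ → ℤ
  f₀ k = if k == i then + 0 else f k
  f₀-i : f₀ i ≡ + 0
  f₀-i rewrite ==-refl i = refl
  f₀-off : ∀ {k} → k ≢ i → f₀ k ≡ f k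
  f₀-off k≢i rewrite ≢⇒==-false k≢i = refl
  only-j : ∀ k → k ≢ j → f₀ k ≡ + 0
  only-j k k≢j with k ≟ i
  ... | yes _   = refl
  ... | no k≢i  = off k k≢i k≢j

∣-sum : ∀ {d n} {f : Fin n → ℤ} → (∀ i → d ∣ f i) → d ∣ sum f
∣-sum {d} {zero}  _   = divides (+ 0) (sym (ℤP.*-zeroˡ d))
∣-sum {d} {suc n} d∣f = ∣m∣n⇒∣m+n (d∣f zero) (∣-sum (d∣f ∘ suc))

∣-sum-except : ∀ {d n} {f : Fin n → ℤ} {i} → d ∣ sum f → (∀ j → j ≢ i → d ∣ f j) → d ∣ f i
∣-sum-except {d} {suc n} {f} {i} d∣Σ d∣others =
  ∣m+n∣n⇒∣m (subst (d ∣_) (sum-remove {i = i} f) d∣Σ) (∣-sum (λ j → d∣others _ (punchInᵢ≢i i j)))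

infixl 6 _[_↦_]
_[_↦_] : ∀ {m} → (Fin m → Bool) → Fin m → Bool → Fin m → Bool
(o [ f ↦ s ]) e = if e == f then s else o e

↦-same : ∀ {m} (o : Fin m → Bool) f s → (o [ f ↦ s ]) f ≡ s
↦-same o f s rewrite ==-refl f = refl

↦-other : ∀ {m} (o : Fin m → Bool) {f e} s → e ≢ f → (o [ f ↦ s ]) e ≡ o e
↦-other o s e≢f rewrite ≢⇒==-false e≢f = refl

residue-cases : ∀ d → + 3 ∣ d ⊎ + 3 ∣ d + + 2 ⊎ + 3 ∣ d + + 4
residue-cases d = by-remainder (d %ℕ 3) (n%ℕd<d d 3) (a≡a%ℕn+[a/ℕn]*n d 3)
  where
  q = d /ℕ 3
  by-remainder : ∀ r → r < 3 → d ≡ + r + q * + 3 → + 3 ∣ d ⊎ + 3 ∣ d + + 2 ⊎ + 3 ∣ d + + 4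
  by-remainder 0 _ d≡ = inj₁ (divides q (trans d≡ (ℤP.+-identityˡ _)))
  by-remainder 1 _ d≡ = inj₂ (inj₁ (divides (q + + 1) (trans (cong (λ x → x + + 2) d≡) (eq₁ q))))
    where eq₁ : ∀ q → + 1 + q * + 3 + + 2 ≡ (q + + 1) * + 3
          eq₁ = solve-∀
  by-remainder 2 _ d≡ = inj₂ (inj₂ (divides (q + + 2) (trans (cong (λ x → x + + 4) d≡) (eq₂ q))))
    where eq₂ : ∀ q → + 2 + q * + 3 + + 4 ≡ (q + + 2) * + 3
          eq₂ = solve-∀
  by-remainder (suc (suc (suc _))) (s≤s (s≤s (s≤s ()))) _

one-of-three-residues : ∀ K t → K ≡₃ t ⊎ K + + 2 ≡₃ t ⊎ K + + 2 + + 2 ≡₃ t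
one-of-three-residues K t with residue-cases (K - t)
... | inj₁ 3∣d          = inj₁ (∣⇒∣ᵤ 3∣d)
... | inj₂ (inj₁ 3∣d+2) = inj₂ (inj₁ (∣⇒∣ᵤ (subst (+ 3 ∣_) (plus-two K t) 3∣d+2)))
  where plus-two : ∀ K t → K - t + + 2 ≡ K + + 2 - t
        plus-two = solve-∀
... | inj₂ (inj₂ 3∣d+4) = inj₂ (inj₂ (∣⇒∣ᵤ (subst (+ 3 ∣_) (plus-four K t) 3∣d+4)))
  where plus-four : ∀ K t → K - t + + 4 ≡ K + + 2 + + 2 - t
        plus-four = solve-∀

≡₃-sym : ∀ {a b} → a ≡₃ b → b ≡₃ a
≡₃-sym {a} {b} a≡₃b = ∣⇒∣ᵤ (subst (+ 3 ∣_) (negate-difference a b) (∣m⇒∣-m (∣ᵤ⇒∣ a≡₃b)))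
  where negate-difference : ∀ a b → - (a - b) ≡ b - a
        negate-difference = solve-∀

data SmallEven : ℤ → Set where
  minus-two : SmallEven -[1+ 1 ]
  balanced  : SmallEven (+ 0)
  plus-two  : SmallEven (+ 2)

SmallEven-shift : ∀ {N} → SmallEven N → SmallEven (N + + 2) → N ≡ + 0 ⊎ N + + 2 ≡ + 0
SmallEven-shift minus-two _ = inj₂ refl
SmallEven-shift balanced  _ = inj₁ refl
SmallEven-shift plus-two  ()

SmallEven-difference : ∀ p q → p ℕ.+ q ≡ 4 → 0 < p → 0 < q → SmallEven (+ p - + q)
SmallEven-difference 1 3 _ _ _ = minus-two
SmallEven-difference 2 2 _ _ _ = balanced
SmallEven-difference 3 1 _ _ _ = plus-two
SmallEven-difference 0 _ _ () _
SmallEven-difference _ 0 _ _ ()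
SmallEven-difference 1 1 () _ _
SmallEven-difference 1 2 () _ _
SmallEven-difference 1 (suc (suc (suc (suc _)))) () _ _
SmallEven-difference 2 1 () _ _
SmallEven-difference 2 (suc (suc (suc _))) () _ _
SmallEven-difference 3 (suc (suc _)) () _ _
SmallEven-difference (suc (suc (suc (suc p)))) (suc q) p+q≡4 _ _ =
  ⊥-elim (ℕP.m+1+n≢0 p (cong (ℕ._∸ 4) p+q≡4))

-- incᵇ G e v unfolds to joins (proj₁ (G e)) (proj₂ (G e)) v, so these facts
-- also apply to the edges of quotient graphs.
joins : ∀ {n} → Fin n → Fin n → Fin n → Bool
joins a b v = not (a == b) ∧ ((a == v) ∨ (b == v))

module _ {n : ℕ} {a b : Fin n} where

  joins-left : a ≢ b → joins a b a ≡ true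
  joins-left a≢b rewrite ≢⇒==-false a≢b | ==-refl a = refl

  joins-right : a ≢ b → joins a b b ≡ true
  joins-right a≢b rewrite ≢⇒==-false a≢b | ==-refl b = refl

  joins-other : ∀ {v} → v ≢ a → v ≢ b → joins a b v ≡ false
  joins-other v≢a v≢b
    rewrite ≢⇒==-false (v≢a ∘ sym) | ≢⇒==-false (v≢b ∘ sym) = BoolP.∧-zeroʳ _

  joins-ends : ∀ {v} → joins a b v ≡ true → a ≡ v ⊎ b ≡ v
  joins-ends {v} ab∋v with a ≟ v | b ≟ v
  ... | yes a≡v | _       = inj₁ a≡v
  ... | no _    | yes b≡v = inj₂ b≡v
  ... | no a≢v  | no b≢v  =
    ⊥-elim (true≢false (trans (sym ab∋v) (BoolP.∧-zeroʳ _)))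

module _ {n m : ℕ} (G : Graph n m) where

  tail-cong : ∀ (o o' : Fin m → Bool) {e} → o e ≡ o' e → tail G o e ≡ tail G o' e
  tail-cong o o' {e} = cong (λ s → if s then proj₁ (G e) else proj₂ (G e))

  head-cong : ∀ (o o' : Fin m → Bool) {e} → o e ≡ o' e → head G o e ≡ head G o' e
  head-cong o o' {e} = cong (λ s → if s then proj₂ (G e) else proj₁ (G e))

  incident-ends : ∀ {e v} → Incident G e v → proj₁ (G e) ≡ v ⊎ proj₂ (G e) ≡ v
  incident-ends {e} = joins-ends {a = proj₁ (G e)} {b = proj₂ (G e)}

  incident-tail-or-head : ∀ o {e v} → Incident G e v → tail G o e ≡ v ⊎ head G o e ≡ v
  incident-tail-or-head o {e} e∋v with o e | incident-ends e∋v
  ... | true  | inj₁ a≡v = inj₁ a≡v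
  ... | true  | inj₂ b≡v = inj₂ b≡v
  ... | false | inj₁ a≡v = inj₂ a≡v
  ... | false | inj₂ b≡v = inj₁ b≡v

  netOut-local : ∀ {o o' : Fin m → Bool} {v} → (∀ e → Incident G e v → o e ≡ o' e) →
    netOut G o v ≡ netOut G o' v
  netOut-local {o} {o'} {v} agree =
    cong₂ (λ p q → + p - + q) (count-cong (at (tail G) (tail-cong o o')))
                                     (count-cong (at (head G) (head-cong o o')))
    where
    at : (end : (Fin m → Bool) → Fin m → Fin n) → (∀ {e} → o e ≡ o' e → end o e ≡ end o' e) →
      ∀ e → (incᵇ G e v ∧ (end o e == v)) ≡ (incᵇ G e v ∧ (end o' e == v))
    at end end-cong e with incᵇ G e v in e∋v
    ... | false = refl
    ... | true  = cong (_== v) (end-cong (agree e e∋v))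

  outFlow : (Fin m → Bool) → Fin n → Fin m → ℤ
  outFlow o v e = 𝟙 (incᵇ G e v ∧ (tail G o e == v)) - 𝟙 (incᵇ G e v ∧ (head G o e == v))

  netOut≡sum-outFlow : ∀ o v → netOut G o v ≡ sum (outFlow o v)
  netOut≡sum-outFlow o v = trans
    (cong₂ _-_ (count≡sum (λ e → incᵇ G e v ∧ (tail G o e == v)))
               (count≡sum (λ e → incᵇ G e v ∧ (head G o e == v))))
    (sym (sum-sub (λ e → 𝟙 (incᵇ G e v ∧ (tail G o e == v)))
                  (λ e → 𝟙 (incᵇ G e v ∧ (head G o e == v)))))

  outFlow-cong : ∀ (o o' : Fin m → Bool) {v e} → o e ≡ o' e → outFlow o v e ≡ outFlow o' v e
  outFlow-cong o o' {v} {e} oe≡o'e =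
    cong₂ (λ t h → 𝟙 (incᵇ G e v ∧ (t == v)) - 𝟙 (incᵇ G e v ∧ (h == v)))
      (tail-cong o o' oe≡o'e) (head-cong o o' oe≡o'e)

  outFlow-off : ∀ o {v e} → tail G o e ≢ v → head G o e ≢ v → outFlow o v e ≡ + 0
  outFlow-off o {v} {e} t≢v h≢v
    rewrite ≢⇒==-false t≢v | ≢⇒==-false h≢v | BoolP.∧-zeroʳ (incᵇ G e v) = refl

  away : Fin n → Fin m → Bool
  away v f = proj₁ (G f) == v

  tail-away : ∀ o {f v} → Incident G f v → o f ≡ away v f → tail G o f ≡ v
  tail-away o {f} {v} f∋v of≡ =
    trans (tail-cong o (λ _ → away v f) of≡)
          (select-end {a = proj₁ (G f)} {b = proj₂ (G f)} (incident-ends f∋v))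

  head-toward : ∀ o {f v} → Incident G f v → o f ≡ not (away v f) → head G o f ≡ v
  head-toward o {f} {v} f∋v of≡ =
    trans (head-cong o (λ _ → not (away v f)) of≡)
          (select-other-end {a = proj₁ (G f)} {b = proj₂ (G f)} (incident-ends f∋v))

  module _ (loopless : Loopless G) where

    incident-tail : ∀ o e → Incident G e (tail G o e)
    incident-tail o e with o e
    ... | true  = joins-left (loopless e)
    ... | false = joins-right (loopless e)

    incident-head : ∀ o e → Incident G e (head G o e)
    incident-head o e with o e
    ... | true  = joins-right (loopless e)
    ... | false = joins-left (loopless e)

    tail≢head : ∀ o e → tail G o e ≢ head G o e
    tail≢head o e with o e
    ... | true  = loopless e
    ... | false = loopless e ∘ sym

    outFlow-tail : ∀ o {e} → outFlow o (tail G o e) e ≡ + 1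
    outFlow-tail o {e} rewrite incident-tail o e | ==-refl (tail G o e)
      | ≢⇒==-false (tail≢head o e ∘ sym) = refl

    outFlow-head : ∀ o {e} → outFlow o (head G o e) e ≡ -1ℤ
    outFlow-head o {e} rewrite incident-head o e | ==-refl (head G o e)
      | ≢⇒==-false (tail≢head o e) = refl

    outdeg+indeg≡deg : ∀ o v → outdeg G o v ℕ.+ indeg G o v ≡ deg G v
    outdeg+indeg≡deg o v = sym (trans
      (count-split (λ e → incᵇ G e v) (λ e → tail G o e == v))
      (cong (outdeg G o v ℕ.+_) (count-cong not-tail⇒head)))
      where
      not-tail⇒head : ∀ e → (incᵇ G e v ∧ not (tail G o e == v)) ≡ (incᵇ G e v ∧ (head G o e == v))
      not-tail⇒head e with incᵇ G e v in e∋v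
      ... | false = refl
      ... | true with incident-tail-or-head o e∋v
      ...   | inj₁ t≡v rewrite t≡v | ==-refl v
              | ≢⇒==-false (λ h≡v → tail≢head o e (trans t≡v (sym h≡v))) = refl
      ...   | inj₂ h≡v rewrite h≡v | ==-refl v
              | ≢⇒==-false (λ t≡v → tail≢head o e (trans t≡v (sym h≡v))) = refl

    netOut-sum-closed : ∀ (R : Fin n → Bool) → (∀ e → R (proj₁ (G e)) ≡ R (proj₂ (G e))) → ∀ o →
      sum (λ v → if R v then netOut G o v else + 0) ≡ + 0
    netOut-sum-closed R closed o = begin
      sum (λ v → if R v then netOut G o v else + 0)
        ≡⟨ sum-cong-≗ (λ v → trans (cong (λ x → if R v then x else + 0) (netOut≡sum-outFlow o v))
                                   (if-sum (R v) (outFlow o v))) ⟩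
      sum (λ v → sum (λ e → if R v then outFlow o v e else + 0))
        ≡⟨ ∑-comm (λ v e → if R v then outFlow o v e else + 0) ⟩
      sum (λ e → sum (λ v → if R v then outFlow o v e else + 0))
        ≡⟨ sum-zero edge-balanced ⟩
      + 0 ∎
      where
      open ≡-Reasoning
      if-sum : ∀ b (g : Fin m → ℤ) → (if b then sum g else + 0) ≡ sum (λ e → if b then g e else + 0)
      if-sum true  g = refl
      if-sum false g = sym (sum-zero {m} (λ _ → refl))
      ends-agree : ∀ e → R (tail G o e) ≡ R (head G o e)
      ends-agree e with o e
      ... | true  = closed e
      ... | false = sym (closed e)
      edge-balanced : ∀ e → sum (λ v → if R v then outFlow o v e else + 0) ≡ + 0
      edge-balanced e = begin
        sum (λ v → if R v then outFlow o v e else + 0)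
          ≡⟨ sum-pair _ (tail≢head o e) off ⟩
        (if R t then outFlow o t e else + 0) + (if R h then outFlow o h e else + 0)
          ≡⟨ cong₂ _+_ (cong (λ x → if R t then x else + 0) (outFlow-tail o))
                       (cong (λ x → if R h then x else + 0) (outFlow-head o)) ⟩
        (if R t then + 1 else + 0) + (if R h then -1ℤ else + 0)
          ≡⟨ cancel (R t) (R h) (ends-agree e) ⟩
        + 0 ∎
        where
        t h : Fin n
        t = tail G o e
        h = head G o e
        off : ∀ v → v ≢ t → v ≢ h → (if R v then outFlow o v e else + 0) ≡ + 0
        off v v≢t v≢h with R v
        ... | true  = outFlow-off o (v≢t ∘ sym) (v≢h ∘ sym)
        ... | false = refl
        cancel : ∀ x y → x ≡ y → (if x then + 1 else + 0) + (if y then -1ℤ else + 0) ≡ + 0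
        cancel true  true  _ = refl
        cancel false false _ = refl

    -- Steering the net flow at a vertex

    netOut-flip : ∀ (o o' : Fin m → Bool) {f v} → (∀ e → e ≢ f → o e ≡ o' e) →
      tail G o f ≡ v → head G o' f ≡ v → netOut G o v ≡ netOut G o' v + + 2
    netOut-flip o o' {f} {v} agree t≡v h≡v = begin
      netOut G o v                               ≡⟨ netOut≡sum-outFlow o v ⟩
      Σo                                         ≡⟨ shift Σo ⟩
      Σo + -1ℤ + + 1                             ≡⟨ cong (λ x → Σo + x + + 1) (sym flow-o') ⟩
      Σo + outFlow o' v f + + 1                  ≡⟨ cong (λ x → x + + 1) exchange ⟩
      Σo' + outFlow o v f + + 1                  ≡⟨ cong (λ x → Σo' + x + + 1) flow-o ⟩
      Σo' + + 1 + + 1                            ≡⟨ ℤP.+-assoc Σo' (+ 1) (+ 1) ⟩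
      Σo' + + 2                                  ≡⟨ cong (λ x → x + + 2) (sym (netOut≡sum-outFlow o' v)) ⟩
      netOut G o' v + + 2                        ∎
      where
      open ≡-Reasoning
      Σo Σo' : ℤ
      Σo  = sum (outFlow o v)
      Σo' = sum (outFlow o' v)
      shift : ∀ x → x ≡ x + -1ℤ + + 1
      shift = solve-∀
      flow-o : outFlow o v f ≡ + 1
      flow-o = subst (λ w → outFlow o w f ≡ + 1) t≡v (outFlow-tail o)
      flow-o' : outFlow o' v f ≡ -1ℤ
      flow-o' = subst (λ w → outFlow o' w f ≡ -1ℤ) h≡v (outFlow-head o')
      exchange : Σo + outFlow o' v f ≡ Σo' + outFlow o v f
      exchange = sum-update (outFlow o v) (outFlow o' v) f (λ e e≢f → outFlow-cong o o' (agree e e≢f))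

    -- Turning f₁ and then f₂ from towards v to away from v raises netOut by 2
    -- each time, and K, K + 2, K + 4 cover all residues mod 3.
    steer-two : ∀ {f₁ f₂ v} → f₁ ≢ f₂ → Incident G f₁ v → Incident G f₂ v → ∀ o t →
      ∃ λ o' → (∀ e → e ≢ f₁ → e ≢ f₂ → o' e ≡ o e) × netOut G o' v ≡₃ t
    steer-two {f₁} {f₂} {v} f₁≢f₂ f₁∋v f₂∋v o t = choose (one-of-three-residues (netOut G o₀ v) t)
      where
      set : Bool → Bool → Fin m → Bool
      set s₁ s₂ = o [ f₂ ↦ s₂ ] [ f₁ ↦ s₁ ]
      a₁ a₂ : Bool
      a₁ = away v f₁
      a₂ = away v f₂
      o₀ o₁ o₂ : Fin m → Bool
      o₀ = set (not a₁) (not a₂)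
      o₁ = set a₁ (not a₂)
      o₂ = set a₁ a₂
      set-off : ∀ s₁ s₂ e → e ≢ f₁ → e ≢ f₂ → set s₁ s₂ e ≡ o e
      set-off s₁ s₂ e e≢f₁ e≢f₂ = trans (↦-other (o [ f₂ ↦ s₂ ]) s₁ e≢f₁) (↦-other o s₂ e≢f₂)
      set-f₁ : ∀ s₁ s₂ → set s₁ s₂ f₁ ≡ s₁
      set-f₁ s₁ s₂ = ↦-same (o [ f₂ ↦ s₂ ]) f₁ s₁
      set-f₂ : ∀ s₁ s₂ → set s₁ s₂ f₂ ≡ s₂
      set-f₂ s₁ s₂ = trans (↦-other (o [ f₂ ↦ s₂ ]) s₁ (f₁≢f₂ ∘ sym)) (↦-same o f₂ s₂)
      agree-off-f₁ : ∀ e → e ≢ f₁ → o₁ e ≡ o₀ e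
      agree-off-f₁ e e≢f₁ = trans (↦-other (o [ f₂ ↦ not a₂ ]) a₁ e≢f₁)
                                  (sym (↦-other (o [ f₂ ↦ not a₂ ]) (not a₁) e≢f₁))
      agree-off-f₂ : ∀ e → e ≢ f₂ → o₂ e ≡ o₁ e
      agree-off-f₂ e e≢f₂ with e ≟ f₁
      ... | yes refl = refl
      ... | no _     = trans (↦-other o a₂ e≢f₂) (sym (↦-other o (not a₂) e≢f₂))
      flip₁ : netOut G o₁ v ≡ netOut G o₀ v + + 2
      flip₁ = netOut-flip o₁ o₀ agree-off-f₁
        (tail-away o₁ f₁∋v (set-f₁ a₁ (not a₂))) (head-toward o₀ f₁∋v (set-f₁ (not a₁) (not a₂)))
      flip₂ : netOut G o₂ v ≡ netOut G o₁ v + + 2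
      flip₂ = netOut-flip o₂ o₁ agree-off-f₂
        (tail-away o₂ f₂∋v (set-f₂ a₁ a₂)) (head-toward o₁ f₂∋v (set-f₂ a₁ (not a₂)))
      choose : let K = netOut G o₀ v in K ≡₃ t ⊎ K + + 2 ≡₃ t ⊎ K + + 2 + + 2 ≡₃ t →
        ∃ λ o' → (∀ e → e ≢ f₁ → e ≢ f₂ → o' e ≡ o e) × netOut G o' v ≡₃ t
      choose (inj₁ r)        = o₀ , set-off _ _ , r
      choose (inj₂ (inj₁ r)) = o₁ , set-off _ _ , subst (_≡₃ t) (sym flip₁) r
      choose (inj₂ (inj₂ r)) = o₂ , set-off _ _ ,
        subst (_≡₃ t) (sym (trans flip₂ (cong (λ x → x + + 2) flip₁))) r

    netOut-degree-four : ∀ o {v e₁ e₂} → deg G v ≡ 4 → tail G o e₁ ≡ v → head G o e₂ ≡ v →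
      SmallEven (netOut G o v)
    netOut-degree-four o {v} {e₁} {e₂} deg≡4 t≡v h≡v =
      SmallEven-difference (outdeg G o v) (indeg G o v) (trans (outdeg+indeg≡deg o v) deg≡4)
      (count-pos (λ e → incᵇ G e v ∧ (tail G o e == v)) out-e₁)
      (count-pos (λ e → incᵇ G e v ∧ (head G o e == v)) in-e₂)
      where
      out-e₁ : (incᵇ G e₁ v ∧ (tail G o e₁ == v)) ≡ true
      out-e₁ = subst (λ w → (incᵇ G e₁ w ∧ (tail G o e₁ == w)) ≡ true) t≡v
        (cong₂ _∧_ (incident-tail o e₁) (==-refl (tail G o e₁)))
      in-e₂ : (incᵇ G e₂ v ∧ (head G o e₂ == v)) ≡ true
      in-e₂ = subst (λ w → (incᵇ G e₂ w ∧ (head G o e₂ == w)) ≡ true) h≡v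
        (cong₂ _∧_ (incident-head o e₂) (==-refl (head G o e₂)))

    -- With one edge out of v and one into v fixed, netOut at v is −2, 0 or 2;
    -- the two directions of f give values differing by 2, so one of them is 0.
    steer-one : ∀ {f e₁ e₂ v} o → deg G v ≡ 4 → Incident G f v → e₁ ≢ f → e₂ ≢ f →
      tail G o e₁ ≡ v → head G o e₂ ≡ v →
      ∃ λ o' → (∀ e → e ≢ f → o' e ≡ o e) × netOut G o' v ≡ + 0
    steer-one {f} {e₁} {e₂} {v} o deg≡4 f∋v e₁≢f e₂≢f t≡v h≡v =
      choose (SmallEven-shift (small (not (away v f))) (subst SmallEven flip (small (away v f))))
      where
      small : ∀ s → SmallEven (netOut G (o [ f ↦ s ]) v)
      small s = netOut-degree-four (o [ f ↦ s ]) deg≡4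
        (trans (tail-cong (o [ f ↦ s ]) o (↦-other o s e₁≢f)) t≡v)
        (trans (head-cong (o [ f ↦ s ]) o (↦-other o s e₂≢f)) h≡v)
      flip : netOut G (o [ f ↦ away v f ]) v ≡ netOut G (o [ f ↦ not (away v f) ]) v + + 2
      flip = netOut-flip (o [ f ↦ away v f ]) (o [ f ↦ not (away v f) ])
        (λ e e≢f → trans (↦-other o _ e≢f) (sym (↦-other o _ e≢f)))
        (tail-away (o [ f ↦ away v f ]) f∋v (↦-same o f (away v f)))
        (head-toward (o [ f ↦ not (away v f) ]) f∋v (↦-same o f (not (away v f))))
      choose : let N = netOut G (o [ f ↦ not (away v f) ]) v in N ≡ + 0 ⊎ N + + 2 ≡ + 0 →
        ∃ λ o' → (∀ e → e ≢ f → o' e ≡ o e) × netOut G o' v ≡ + 0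
      choose (inj₁ balanced⁻) = o [ f ↦ not (away v f) ] , (λ e e≢f → ↦-other o _ e≢f) , balanced⁻
      choose (inj₂ balanced⁺) = o [ f ↦ away v f ] , (λ e e≢f → ↦-other o _ e≢f) , trans flip balanced⁺

-- Components

module _ {n m : ℕ} (G : Graph n m) where

  Adj-sym : ∀ {u v} → Adj G u v → Adj G v u
  Adj-sym (e , e∋u , e∋v , u≢v) = e , e∋v , e∋u , u≢v ∘ sym

  adjacent? : ∀ u v → Dec (Adj G u v)
  adjacent? u v =
    any? (λ e → (incᵇ G e u BoolP.≟ true) ×-dec (incᵇ G e v BoolP.≟ true) ×-dec ¬? (u ≟ v))

  walk-start : ∀ {S u w} → WalkIn G S u w → S u
  walk-start (here Su)     = Su
  walk-start (step Su _ _) = Su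

  walk-end : ∀ {S u w} → WalkIn G S u w → S w
  walk-end (here Sw)       = Sw
  walk-end (step _ _ rest) = walk-end rest

  walk-snoc : ∀ {S u a b} → WalkIn G S u a → S b → Adj G a b → WalkIn G S u b
  walk-snoc (here Sa)        Sb ab = step Sa ab (here Sb)
  walk-snoc (step Su uv rest) Sb ab = step Su uv (walk-snoc rest Sb ab)

  record Component (S : Fin n → Set) (u : Fin n) : Set where
    field
      member      : Fin n → Bool
      member-root : member u ≡ true
      walk        : ∀ {w} → member w ≡ true → WalkIn G S u w
      closed      : ∀ {a b} → member a ≡ true → S b → Adj G a b → member b ≡ true

    member-≢ : ∀ {a b} → member a ≡ true → member b ≡ false → a ≢ b
    member-≢ = ≢-by member

    member-walk : ∀ {a w} → member a ≡ true → WalkIn G S a w → member w ≡ true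
    member-walk a∈ (here _)        = a∈
    member-walk a∈ (step _ ab rest) = member-walk (closed a∈ (walk-start rest) ab) rest

    member-adjacent : ∀ {a b} → S a → S b → Adj G a b → member a ≡ member b
    member-adjacent {a} {b} Sa Sb ab with member a in a∈ | member b in b∈
    ... | true  | true  = refl
    ... | false | false = refl
    ... | true  | false = ⊥-elim (true≢false (trans (sym (closed a∈ Sb ab)) b∈))
    ... | false | true  = ⊥-elim (true≢false (trans (sym (closed b∈ Sa (Adj-sym ab))) a∈))

  module _ {S : Fin n → Set} (S? : Decidable S) {u : Fin n} where

    private
      Frontier : (Fin n → Bool) → Set
      Frontier R = ∃₂ λ a b → R a ≡ true × R b ≡ false × S b × Adj G a b

      frontier? : ∀ R → Dec (Frontier R)
      frontier? R = any? λ a → any? λ b →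
        (R a BoolP.≟ true) ×-dec (R b BoolP.≟ false) ×-dec S? b ×-dec adjacent? a b

      grow : ∀ k (R : Fin n → Bool) → R u ≡ true → (∀ {w} → R w ≡ true → WalkIn G S u w) →
        count (not ∘ R) ≤ k → Component S u
      grow k R root walk _ with frontier? R
      ... | no no-frontier = record
        { member = R ; member-root = root ; walk = walk ; closed = closed }
        where
        closed : ∀ {a b} → R a ≡ true → S b → Adj G a b → R b ≡ true
        closed {a} {b} a∈ Sb ab with R b in b∈
        ... | true  = refl
        ... | false = ⊥-elim (no-frontier (a , b , a∈ , b∈ , Sb , ab))
      grow zero R root walk size | yes (a , b , a∈ , b∉ , Sb , ab) =
        ⊥-elim (ℕP.<⇒≱ (count-pos (not ∘ R) (cong not b∉)) size)
      grow (suc k) R root walk size | yes (a , b , a∈ , b∉ , Sb , ab) =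
        grow k R' root' walk' (ℕP.≤-pred (ℕP.<-≤-trans shrinks size))
        where
        R' : Fin n → Bool
        R' w = R w ∨ (w == b)
        root' : R' u ≡ true
        root' rewrite root = refl
        walk' : ∀ {w} → R' w ≡ true → WalkIn G S u w
        walk' {w} w∈ with R w in w∈R
        ... | true  = walk w∈R
        ... | false = subst (WalkIn G S u) (sym (==⇒≡ w∈)) (walk-snoc (walk a∈) Sb ab)
        shrinks : count (not ∘ R') < count (not ∘ R)
        shrinks = count-< sub b-added (cong not b∉)
          where
          sub : ∀ i → not (R' i) ≡ true → not (R i) ≡ true
          sub i i∉ with R i
          ... | true  = i∉
          ... | false = refl
          b-added : not (R' b) ≡ false
          b-added rewrite ==-refl b | BoolP.∨-zeroʳ (R b) = refl

    component : S u → Component S u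
    component Su = grow n (_== u) (==-refl u) start (count≤size _)
      where
      start : ∀ {w} → (w == u) ≡ true → WalkIn G S u w
      start w==u = subst (WalkIn G S u) (sym (==⇒≡ w==u)) (here Su)

-- Boundaries

AgreesAt : ∀ {n m} → Graph n m → Fin n → (Fin m → Bool) → (Fin m → Bool) → Set
AgreesAt G z o ψ = ∀ e → Incident G e z → o e ≡ ψ e

module _ {n m : ℕ} {G : Graph n m} (loopless : Loopless G)
         {β : Fin n → ℤ} (boundary : IsBoundary G β) where

  flow-from-all-but-one : ∀ o c → (∀ v → v ≢ c → netOut G o v ≡₃ β v) → IsNZFlow G β o
  flow-from-all-but-one o c valid v with v ≟ c
  ... | no v≢c   = valid v v≢c
  ... | yes refl = ∣⇒∣ᵤ (subst (+ 3 ∣_) defect-at-v (∣-sum-except 3∣Σdefect 3∣defect))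
    where
    open Component (component G {S = Everything G} (λ w → yes w) v)
    restrict : (Fin n → ℤ) → Fin n → ℤ
    restrict f w = if member w then f w else + 0
    defect : Fin n → ℤ
    defect w = if member w then netOut G o w - β w else + 0
    closed-edges : ∀ e → member (proj₁ (G e)) ≡ member (proj₂ (G e))
    closed-edges e = member-adjacent (proj₁ (G e)) (proj₂ (G e))
      (e , joins-left (loopless e) , joins-right (loopless e) , loopless e)
    Σdefect : sum defect ≡ - sum (restrict β)
    Σdefect = begin
      sum defect
        ≡⟨ sum-cong-≗ split ⟩
      sum (λ w → restrict (netOut G o) w - restrict β w)
        ≡⟨ sum-sub (restrict (netOut G o)) (restrict β) ⟩
      sum (restrict (netOut G o)) - sum (restrict β)
        ≡⟨ cong (_- sum (restrict β)) (netOut-sum-closed G loopless member closed-edges o) ⟩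
      + 0 - sum (restrict β)
        ≡⟨ ℤP.+-identityˡ _ ⟩
      - sum (restrict β) ∎
      where
      open ≡-Reasoning
      split : ∀ w → defect w ≡ restrict (netOut G o) w - restrict β w
      split w with member w
      ... | true  = refl
      ... | false = refl
    3∣Σrestrictβ : + 3 ∣ sum (restrict β)
    3∣Σrestrictβ = subst (+ 3 ∣_) (trans (ℤP.+-identityʳ _) (sumℤ≡sum (restrict β)))
      (∣ᵤ⇒∣ (boundary v member (λ w → mk⇔ walk (member-walk member-root))))
    3∣Σdefect : + 3 ∣ sum defect
    3∣Σdefect = subst (+ 3 ∣_) (sym Σdefect) (∣m⇒∣-m 3∣Σrestrictβ)
    3∣defect : ∀ w → w ≢ v → + 3 ∣ defect w
    3∣defect w w≢v with member w
    ... | true  = ∣ᵤ⇒∣ (valid w w≢v)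
    ... | false = divides (+ 0) refl
    defect-at-v : defect v ≡ netOut G o v - β v
    defect-at-v rewrite member-root = refl

  extends-from-all-but-one : ∀ {z ψ} → IsTipPreflow G β z ψ → ∀ o c → AgreesAt G z o ψ →
    (∀ v → v ≢ c → v ≢ z → netOut G o v ≡₃ β v) → Extends G β z ψ
  extends-from-all-but-one {z} {ψ} preflow o c agree valid =
    o , flow-from-all-but-one o c valid-off-c , agree
    where
    valid-off-c : ∀ v → v ≢ c → netOut G o v ≡₃ β v
    valid-off-c v v≢c with v ≟ z
    ... | yes refl = subst (_≡₃ β v) (sym (netOut-local G agree)) preflow
    ... | no v≢z   = valid v v≢c v≢z

-- Quotients

-- TipRespecting p z unfolds to SingletonPart p z.
SingletonPart : ∀ {n k} → (Fin n → Fin k) → Fin n → Set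
SingletonPart p v = ∀ w → p w ≡ p v → w ≡ v

module _ {n k : ℕ} {p : Fin n → Fin k} {v : Fin n} (single : SingletonPart p v) where

  ==-singleton : ∀ w → (p w == p v) ≡ (w == v)
  ==-singleton w with w ≟ v
  ... | yes refl = ==-refl (p w)
  ... | no w≢v   = ≢⇒==-false (w≢v ∘ single w)

  joins-singleton : ∀ a b → joins (p a) (p b) (p v) ≡ joins a b v
  joins-singleton a b rewrite ==-singleton a | ==-singleton b with a ≟ v | b ≟ v
  ... | no _     | no _     = trans (BoolP.∧-zeroʳ _) (sym (BoolP.∧-zeroʳ _))
  ... | yes refl | yes refl rewrite ==-refl (p a) | ==-refl a = refl
  ... | yes refl | no b≢a
    rewrite ≢⇒==-false {i = p a} (λ pa≡pb → b≢a (single b (sym pa≡pb))) | ≢⇒==-false (b≢a ∘ sym) = refl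
  ... | no a≢b   | yes refl
    rewrite ≢⇒==-false {i = p a} (λ pa≡pb → a≢b (single a pa≡pb)) | ≢⇒==-false a≢b = refl

module _ {n m k : ℕ} (G : Graph n m) (p : Fin n → Fin k) where

  tail-quot : ∀ o e → tail (quotG G p) o e ≡ p (tail G o e)
  tail-quot o e with o e
  ... | true  = refl
  ... | false = refl

  head-quot : ∀ o e → head (quotG G p) o e ≡ p (head G o e)
  head-quot o e with o e
  ... | true  = refl
  ... | false = refl

  module _ {v : Fin n} (single : SingletonPart p v) where

    netOut-quot : ∀ o → netOut (quotG G p) o (p v) ≡ netOut G o v
    netOut-quot o = cong₂ (λ out in′ → + out - + in′)
      (count-cong (λ e → cong₂ _∧_ (joins-singleton single _ _) (end-singleton (tail-quot o e))))
      (count-cong (λ e → cong₂ _∧_ (joins-singleton single _ _) (end-singleton (head-quot o e))))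
      where
      end-singleton : ∀ {x w} → x ≡ p w → (x == p v) ≡ (w == v)
      end-singleton {w = w} refl = ==-singleton single w

    quotβ-singleton : ∀ β → quotβ β p (p v) ≡ β v
    quotβ-singleton β = begin
      quotβ β p (p v)  ≡⟨ sumℤ≡sum f ⟩
      sum f            ≡⟨ sum-single f v off ⟩
      f v              ≡⟨ at-v ⟩
      β v              ∎
      where
      open ≡-Reasoning
      f : Fin n → ℤ
      f w = if p w == p v then β w else + 0
      off : ∀ w → w ≢ v → f w ≡ + 0
      off w w≢v rewrite ==-singleton single w | ≢⇒==-false w≢v = refl
      at-v : f v ≡ β v
      at-v rewrite ==-refl (p v) = refl

  quotient-flow-restricts : ∀ {β z ψ φ} → SingletonPart p z →
    IsNZFlow (quotG G p) (quotβ β p) φ → AgreesAt (quotG G p) (p z) φ ψ →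
    AgreesAt G z φ ψ × (∀ v → SingletonPart p v → netOut G φ v ≡₃ β v)
  quotient-flow-restricts {β} {φ = φ} z-single flow agree =
    (λ e e∋z → agree e (trans (joins-singleton z-single _ _) e∋z)) ,
    (λ v v-single → subst₂ _≡₃_ (netOut-quot v-single φ) (quotβ-singleton v-single β) (flow (p v)))

module _ {n : ℕ} {c b : Fin (suc n)} (c≢b : c ≢ b) where

  merge : Fin (suc n) → Fin n
  merge v with v ≟ b
  ... | yes _  = punchOut (c≢b ∘ sym)
  ... | no v≢b = punchOut (v≢b ∘ sym)

  merge-identifies : merge c ≡ merge b
  merge-identifies with c ≟ b | b ≟ b
  ... | yes c≡b | _      = ⊥-elim (c≢b c≡b)
  ... | no _    | yes _  = punchOut-cong b refl
  ... | no _    | no b≢b = ⊥-elim (b≢b refl)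

  merge-surjective : Surjective merge
  merge-surjective j = punchIn b j , merged
    where
    merged : merge (punchIn b j) ≡ j
    merged with punchIn b j ≟ b
    ... | yes eq = ⊥-elim (punchInᵢ≢i b j eq)
    ... | no _   = trans (punchOut-cong b refl) (punchOut-punchIn b)

  merge-singleton : ∀ {v} → v ≢ b → v ≢ c → SingletonPart merge v
  merge-singleton {v} v≢b v≢c w same with v ≟ b
  ... | yes v≡b = ⊥-elim (v≢b v≡b)
  ... | no v≢b′ with w ≟ b
  ...   | yes _  = ⊥-elim (v≢c (sym (punchOut-injective (c≢b ∘ sym) (v≢b′ ∘ sym) same)))
  ...   | no w≢b = punchOut-injective (w≢b ∘ sym) (v≢b′ ∘ sym) same

ExtendsInProperQuotients : ∀ {n m} → Graph n m → (Fin n → ℤ) → Fin n → (Fin m → Bool) → Set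
ExtendsInProperQuotients {n} G β z ψ =
  ∀ (k : ℕ) (p : Fin n → Fin k) → Surjective p → NonTrivial p → TipRespecting p z →
    Extends (quotG G p) (quotβ β p) (p z) ψ

merge-flow : ∀ {n m} {G : Graph n m} {β z ψ} → ExtendsInProperQuotients G β z ψ →
  ∀ {c b} → c ≢ b → z ≢ b → z ≢ c →
  ∃ λ φ → AgreesAt G z φ ψ × (∀ v → v ≢ b → v ≢ c → netOut G φ v ≡₃ β v)
merge-flow {zero} _ {c = ()}
merge-flow {suc n} {G = G} quotients c≢b z≢b z≢c
  with quotients n (merge c≢b) (merge-surjective c≢b) (_ , _ , c≢b , merge-identifies c≢b)
                 (merge-singleton c≢b z≢b z≢c)
... | φ , flow , agree with quotient-flow-restricts G (merge c≢b) (merge-singleton c≢b z≢b z≢c) flow agree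
...   | agree-z , valid = φ , agree-z , λ v v≢b v≢c → valid v (merge-singleton c≢b v≢b v≢c)

-- Separations

module _ {n m : ℕ} (G : Graph n m) where

  record Separation (z c : Fin n) : Set where
    field
      side        : Fin n → Bool
      inner outer : Fin n
      inner-side  : side inner ≡ true
      outer-side  : side outer ≡ false
      outer≢z     : outer ≢ z
      outer≢c     : outer ≢ c
      z-side      : side z ≡ false
      c-side      : side c ≡ false
      no-crossing : ∀ {a w} → side a ≡ true → side w ≡ false → w ≢ z → w ≢ c → ¬ Adj G a w

  component-separation : ∀ {S u} (C : Component G S u) {z c} → ¬ S z → (∀ {w} → w ≢ z → w ≢ c → S w) →
    ∀ {a b} → Component.member C a ≡ true → a ≢ c → Component.member C b ≡ false → b ≢ z → b ≢ c →
    Separation z c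
  component-separation C {z} {c} ¬Sz S-off {a} {b} a∈ a≢c b∉ b≢z b≢c = record
    { side        = side
    ; inner       = a
    ; outer       = b
    ; inner-side  = inner-side
    ; outer-side  = outer-side
    ; outer≢z     = b≢z
    ; outer≢c     = b≢c
    ; z-side      = z-side
    ; c-side      = c-side
    ; no-crossing = no-crossing
    }
    where
    open Component C
    side : Fin n → Bool
    side w = member w ∧ not (w == c)
    c-side : side c ≡ false
    c-side rewrite ==-refl c = BoolP.∧-zeroʳ (member c)
    inner-side : side a ≡ true
    inner-side rewrite a∈ | ≢⇒==-false a≢c = refl
    outer-side : side b ≡ false
    outer-side rewrite b∉ = refl
    z∉ : member z ≡ false
    z∉ with member z in z∈
    ... | true  = ⊥-elim (¬Sz (walk-end G (walk z∈)))
    ... | false = refl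
    z-side : side z ≡ false
    z-side rewrite z∉ = refl
    no-crossing : ∀ {a' w} → side a' ≡ true → side w ≡ false → w ≢ z → w ≢ c → ¬ Adj G a' w
    no-crossing {w = w} a'-side w-side w≢z w≢c a'w = true≢false (trans (sym w∈) w∉)
      where
      w∈ : member w ≡ true
      w∈ = closed (∧-true-left a'-side) (S-off w≢z w≢c) a'w
      w∉ : member w ≡ false
      w∉ = trans (sym (BoolP.∧-identityʳ (member w)))
             (trans (cong (λ x → member w ∧ not x) (sym (≢⇒==-false w≢c))) w-side)

module _ {n m : ℕ} {G : Graph n m} (loopless : Loopless G) {β : Fin n → ℤ} (boundary : IsBoundary G β)
         {z : Fin n} {ψ : Fin m → Bool} (preflow : IsTipPreflow G β z ψ)
         (quotients : ExtendsInProperQuotients G β z ψ) where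

  separation-extends : ∀ {c} → c ≢ z → Separation G z c → Extends G β z ψ
  separation-extends {c} c≢z sep = extends-from-all-but-one loopless boundary preflow glued c agree valid
    where
    open Separation sep
    outside : ∃ λ φ → AgreesAt G z φ ψ × (∀ v → v ≢ outer → v ≢ c → netOut G φ v ≡₃ β v)
    outside = merge-flow quotients (outer≢c ∘ sym) (outer≢z ∘ sym) (c≢z ∘ sym)
    inside : ∃ λ φ → AgreesAt G z φ ψ × (∀ v → v ≢ inner → v ≢ c → netOut G φ v ≡₃ β v)
    inside = merge-flow quotients (≢-by side inner-side c-side ∘ sym) (≢-by side inner-side z-side ∘ sym)
      (c≢z ∘ sym)
    touches : Fin m → Bool
    touches e = side (proj₁ (G e)) ∨ side (proj₂ (G e))
    glued : Fin m → Bool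
    glued e = if touches e then proj₁ outside e else proj₁ inside e
    agree : AgreesAt G z glued ψ
    agree e e∋z with touches e
    ... | true  = proj₁ (proj₂ outside) e e∋z
    ... | false = proj₁ (proj₂ inside) e e∋z
    touches-inner : ∀ {e v} → Incident G e v → side v ≡ true → touches e ≡ true
    touches-inner {e} e∋v v-side with incident-ends G e∋v
    ... | inj₁ refl rewrite v-side = refl
    ... | inj₂ refl rewrite v-side = BoolP.∨-zeroʳ _
    touches-outer : ∀ {e v} → Incident G e v → side v ≡ false → v ≢ z → v ≢ c → touches e ≡ false
    touches-outer {e} {v} e∋v v-side v≢z v≢c
      with side (proj₁ (G e)) in a-side | side (proj₂ (G e)) in b-side
    ... | false | false = refl
    ... | true  | _     = ⊥-elim (no-crossing a-side v-side v≢z v≢c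
                            (e , joins-left (loopless e) , e∋v , ≢-by side a-side v-side))
    ... | false | true  = ⊥-elim (no-crossing b-side v-side v≢z v≢c
                            (e , joins-right (loopless e) , e∋v , ≢-by side b-side v-side))
    valid : ∀ v → v ≢ c → v ≢ z → netOut G glued v ≡₃ β v
    valid v v≢c v≢z with side v in v-side
    ... | true  = subst (_≡₃ β v) (sym (netOut-local G glued-outside))
                    (proj₂ (proj₂ outside) v (≢-by side v-side outer-side) v≢c)
      where
      glued-outside : ∀ e → Incident G e v → glued e ≡ proj₁ outside e
      glued-outside e e∋v rewrite touches-inner e∋v v-side = refl
    ... | false = subst (_≡₃ β v) (sym (netOut-local G glued-inside))
                    (proj₂ (proj₂ inside) v (≢-by side inner-side v-side ∘ sym) v≢c)
      where
      glued-inside : ∀ e → Incident G e v → glued e ≡ proj₁ inside e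
      glued-inside e e∋v rewrite touches-outer e∋v v-side v≢z v≢c = refl

ThreeDistinct : ∀ {n} → (Fin n → Set) → Set
ThreeDistinct S = ∃[ a ] ∃[ b ] ∃[ c ] (S a × S b × S c × a ≢ b × a ≢ c × b ≢ c)

third-vertex : ∀ {n} {S : Fin n → Set} → ThreeDistinct S → ∀ u v → ∃ λ t → S t × t ≢ u × t ≢ v
third-vertex (a , b , c , Sa , Sb , Sc , a≢b , a≢c , b≢c) u v with a ≟ u | a ≟ v | b ≟ u | b ≟ v
... | no a≢u   | no a≢v   | _        | _        = a , Sa , a≢u , a≢v
... | _        | _        | no b≢u   | no b≢v   = b , Sb , b≢u , b≢v
... | yes refl | _        | yes refl | _        = ⊥-elim (a≢b refl)
... | _        | yes refl | _        | yes refl = ⊥-elim (a≢b refl)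
... | yes refl | _        | _        | yes refl = c , Sc , a≢c ∘ sym , b≢c ∘ sym
... | _        | yes refl | yes refl | _        = c , Sc , b≢c ∘ sym , a≢c ∘ sym

module _ {n m : ℕ} {G : Graph n m} {z : Fin n} (no-separation : ∀ {c} → c ≢ z → ¬ Separation G z c) where

  open Component

  unseparated⇒connected : ThreeDistinct (λ v → v ≢ z) → ConnectedOn G (λ v → v ≢ z)
  unseparated⇒connected three u v u≢z v≢z = reach (component G (λ w → ¬? (w ≟ z)) u≢z)
    where
    reach : Component G (λ w → w ≢ z) u → WalkIn G (λ w → w ≢ z) u v
    reach C with member C v in v∈
    ... | true  = walk C v∈
    ... | false with third-vertex three u v
    ...   | t , t≢z , t≢u , t≢v with member C t in t∈
    ...     | true  = ⊥-elim (no-separation u≢z (component-separation G C (λ z≢z → z≢z refl)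
                        (λ w≢z _ → w≢z) t∈ t≢u v∈ v≢z (member-≢ C (member-root C) v∈ ∘ sym)))
    ...     | false = ⊥-elim (no-separation v≢z (component-separation G C (λ z≢z → z≢z refl)
                        (λ w≢z _ → w≢z) (member-root C) (member-≢ C (member-root C) v∈) t∈ t≢z t≢v))

  unseparated⇒connected-avoiding : ∀ w → w ≢ z → ConnectedOn G (λ v → v ≢ z × v ≢ w)
  unseparated⇒connected-avoiding w w≢z u v (u≢z , u≢w) (v≢z , v≢w) =
    reach (component G (λ v → ¬? (v ≟ z) ×-dec ¬? (v ≟ w)) (u≢z , u≢w))
    where
    reach : Component G (λ v → v ≢ z × v ≢ w) u → WalkIn G (λ v → v ≢ z × v ≢ w) u v
    reach C with member C v in v∈
    ... | true  = walk C v∈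
    ... | false = ⊥-elim (no-separation w≢z (component-separation G C (λ Sz → proj₁ Sz refl) _,_
                    (member-root C) u≢w v∈ v≢z v≢w))

-- Three vertices

τ≡0⇒β≡₃0 : ∀ {n m} (G : Graph n m) β v → deg G v % 2 ≡ 0 → tauAbs G β v ≡ 0 → β v ≡₃ + 0
τ≡0⇒β≡₃0 G β v even τ≡0 with deg G v % 2 | isZero₃ (β v) in β≡₃0
... | zero | true  = subst (λ a → 3 ℕD.∣ ℤ.∣ a ∣) (sym (ℤP.+-identityʳ (β v)))
                      (does⇒ (3 ℕD.∣? ℤ.∣ β v ∣) β≡₃0)
τ≡0⇒β≡₃0 G β v even () | zero  | false
τ≡0⇒β≡₃0 G β v ()   _  | suc _ | _

degree-squeeze : ∀ b c t → c ≤ 1 → b ≤ c ℕ.+ 2 → 4 ℕ.+ t ≤ b ℕ.+ c → b ≡ 3 × c ≡ 1 × t ≡ 0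
degree-squeeze 3 1 0 _ _ _ = refl , refl , refl
degree-squeeze _ (suc (suc _)) _ (s≤s ()) _ _
degree-squeeze 0 0 _ _ _ ()
degree-squeeze 1 0 _ _ _ (s≤s ())
degree-squeeze 2 0 _ _ _ (s≤s (s≤s ()))
degree-squeeze (suc (suc (suc _))) 0 _ _ (s≤s (s≤s ())) _
degree-squeeze 0 1 _ _ _ (s≤s ())
degree-squeeze 1 1 _ _ _ (s≤s (s≤s ()))
degree-squeeze 2 1 _ _ _ (s≤s (s≤s (s≤s ())))
degree-squeeze 3 1 (suc _) _ _ (s≤s (s≤s (s≤s (s≤s ()))))
degree-squeeze (suc (suc (suc (suc _)))) 1 _ _ (s≤s (s≤s (s≤s ()))) _

data ExactlyTwo : Bool → Bool → Bool → Set where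
  ttf : ExactlyTwo true true false
  tft : ExactlyTwo true false true
  ftt : ExactlyTwo false true true

covered-by-three : ∀ {n} {z x y : Fin n} → ¬ (∃ λ w → w ≢ z × w ≢ x × w ≢ y) →
  ∀ v → v ≡ z ⊎ v ≡ x ⊎ v ≡ y
covered-by-three {z = z} {x} {y} none v with v ≟ z | v ≟ x | v ≟ y
... | yes v≡z | _       | _       = inj₁ v≡z
... | no _    | yes v≡x | _       = inj₂ (inj₁ v≡x)
... | no _    | no _    | yes v≡y = inj₂ (inj₂ v≡y)
... | no v≢z  | no v≢x  | no v≢y  = ⊥-elim (none (v , v≢z , v≢x , v≢y))

module _ {n m : ℕ} {G : Graph n m} (loopless : Loopless G) {β : Fin n → ℤ} (boundary : IsBoundary G β)
         {z x y : Fin n} {ψ : Fin m → Bool} (preflow : IsTipPreflow G β z ψ)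
         (x≢z : x ≢ z) (y≢z : y ≢ z) (y≢x : y ≢ x) (cover : ∀ v → v ≡ z ⊎ v ≡ x ⊎ v ≡ y) where

  private
    iz ix iy free : Fin m → Bool
    iz e = incᵇ G e z
    ix e = incᵇ G e x
    iy e = incᵇ G e y
    free e = iy e ∧ not (iz e)  -- the x–y edges: ψ does not prescribe their direction

    Zx Zy F : ℕ
    Zx = count (λ e → iz e ∧ ix e)
    Zy = count (λ e → iy e ∧ iz e)
    F  = count free

    exactlyTwo : ∀ e → ExactlyTwo (iz e) (ix e) (iy e)
    exactlyTwo e = classify (loopless e) (cover (proj₁ (G e))) (cover (proj₂ (G e)))
      where
      classify : ∀ {a b} → a ≢ b → a ≡ z ⊎ a ≡ x ⊎ a ≡ y → b ≡ z ⊎ b ≡ x ⊎ b ≡ y →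
        ExactlyTwo (joins a b z) (joins a b x) (joins a b y)
      classify a≢b (inj₁ refl)        (inj₁ refl)        = ⊥-elim (a≢b refl)
      classify a≢b (inj₂ (inj₁ refl)) (inj₂ (inj₁ refl)) = ⊥-elim (a≢b refl)
      classify a≢b (inj₂ (inj₂ refl)) (inj₂ (inj₂ refl)) = ⊥-elim (a≢b refl)
      classify a≢b (inj₁ refl) (inj₂ (inj₁ refl))
        rewrite joins-left a≢b | joins-right a≢b | joins-other y≢z y≢x = ttf
      classify a≢b (inj₁ refl) (inj₂ (inj₂ refl))
        rewrite joins-left a≢b | joins-right a≢b | joins-other x≢z (y≢x ∘ sym) = tft
      classify a≢b (inj₂ (inj₁ refl)) (inj₁ refl)
        rewrite joins-left a≢b | joins-right a≢b | joins-other y≢x y≢z = ttf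
      classify a≢b (inj₂ (inj₁ refl)) (inj₂ (inj₂ refl))
        rewrite joins-left a≢b | joins-right a≢b | joins-other (x≢z ∘ sym) (y≢z ∘ sym) = ftt
      classify a≢b (inj₂ (inj₂ refl)) (inj₁ refl)
        rewrite joins-left a≢b | joins-right a≢b | joins-other (y≢x ∘ sym) x≢z = tft
      classify a≢b (inj₂ (inj₂ refl)) (inj₂ (inj₁ refl))
        rewrite joins-left a≢b | joins-right a≢b | joins-other (y≢z ∘ sym) (x≢z ∘ sym) = ftt

    z-not-x : ∀ {p q r} → ExactlyTwo p q r → (p ∧ not q) ≡ (r ∧ p)
    z-not-x ttf = refl
    z-not-x tft = refl
    z-not-x ftt = refl

    x-not-z : ∀ {p q r} → ExactlyTwo p q r → (q ∧ not p) ≡ (r ∧ not p)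
    x-not-z ttf = refl
    x-not-z tft = refl
    x-not-z ftt = refl

    z-not-x⇒y : ∀ {p q r} → ExactlyTwo p q r → p ≡ true → q ≡ false → r ≡ true
    z-not-x⇒y tft _ _ = refl

    deg-z : deg G z ≡ Zx ℕ.+ Zy
    deg-z = trans (count-split iz ix) (cong (Zx ℕ.+_) (count-cong (z-not-x ∘ exactlyTwo)))

    deg-x : deg G x ≡ Zx ℕ.+ F
    deg-x = trans (count-split ix iz)
      (cong₂ ℕ._+_ (count-cong (λ e → BoolP.∧-comm (ix e) (iz e))) (count-cong (x-not-z ∘ exactlyTwo)))

    deg-y : deg G y ≡ Zy ℕ.+ F
    deg-y = count-split iy iz

    free⇒¬z : ∀ {e f} → Incident G e z → free f ≡ true → e ≢ f
    free⇒¬z {f = f} e∋z free-f refl = true≢false (trans (sym e∋z) (free-not-z (iy f) (iz f) free-f))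
      where
      free-not-z : ∀ a b → a ∧ not b ≡ true → b ≡ false
      free-not-z true false _ = refl

    extends-if-y-valid : ∀ o → AgreesAt G z o ψ → netOut G o y ≡₃ β y → Extends G β z ψ
    extends-if-y-valid o agree y-valid = extends-from-all-but-one loopless boundary preflow o x agree only-y
      where
      only-y : ∀ v → v ≢ x → v ≢ z → netOut G o v ≡₃ β v
      only-y v v≢x v≢z with cover v
      ... | inj₁ v≡z        = ⊥-elim (v≢z v≡z)
      ... | inj₂ (inj₁ v≡x) = ⊥-elim (v≢x v≡x)
      ... | inj₂ (inj₂ refl) = y-valid

    two-free-edges-extend : ∀ {f₁ f₂} → f₁ ≢ f₂ → free f₁ ≡ true → free f₂ ≡ true → Extends G β z ψ
    two-free-edges-extend f₁≢f₂ free₁ free₂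
      with steer-two G loopless f₁≢f₂ (∧-true-left free₁) (∧-true-left free₂) ψ (β y)
    ... | o , off , y-valid =
      extends-if-y-valid o (λ e e∋z → off e (free⇒¬z e∋z free₁) (free⇒¬z e∋z free₂)) y-valid

    squeeze : F ≤ 1 → Tall G β z x ψ → Tame G β z x ψ → Zy ≡ 3 × F ≡ 1 × tauAbs G β y ≡ 0
    squeeze few (z≤x+2 , _) tame = degree-squeeze Zy F (tauAbs G β y) few
      (ℕP.+-cancelˡ-≤ Zx _ _
        (subst₂ _≤_ deg-z (trans (cong (ℕ._+ 2) deg-x) (ℕP.+-assoc Zx F 2)) z≤x+2))
      (subst (4 ℕ.+ tauAbs G β y ≤_) deg-y (tame y y≢x y≢z))

    deg-y≡4 : Zy ≡ 3 → F ≡ 1 → deg G y ≡ 4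
    deg-y≡4 Zy≡3 F≡1 = trans deg-y (cong₂ ℕ._+_ Zy≡3 F≡1)

    z-excess : Zy ≡ 3 → F ≡ 1 → deg G z ≡ deg G x ℕ.+ 2
    z-excess Zy≡3 F≡1 = begin
      deg G z            ≡⟨ deg-z ⟩
      Zx ℕ.+ Zy          ≡⟨ cong (Zx ℕ.+_) Zy≡3 ⟩
      Zx ℕ.+ (1 ℕ.+ 2)   ≡⟨ sym (ℕP.+-assoc Zx 1 2) ⟩
      Zx ℕ.+ 1 ℕ.+ 2     ≡⟨ cong (λ k → Zx ℕ.+ k ℕ.+ 2) (sym F≡1) ⟩
      Zx ℕ.+ F ℕ.+ 2     ≡⟨ cong (ℕ._+ 2) (sym deg-x) ⟩
      deg G x ℕ.+ 2      ∎
      where open ≡-Reasoning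

    end-at-y : ∀ {e} → Incident G e z → ¬ Incident G e x → Incident G e y
    end-at-y {e} e∋z e∌x = z-not-x⇒y (exactlyTwo e) e∋z (BoolP.¬-not e∌x)

    tail-at-y : ∀ {e} → Incident G e z → ¬ Incident G e x → head G ψ e ≡ z → tail G ψ e ≡ y
    tail-at-y e∋z e∌x head≡z with incident-tail-or-head G ψ (end-at-y e∋z e∌x)
    ... | inj₁ t≡y = t≡y
    ... | inj₂ h≡y = ⊥-elim (y≢z (trans (sym h≡y) head≡z))

    head-at-y : ∀ {e} → Incident G e z → ¬ Incident G e x → tail G ψ e ≡ z → head G ψ e ≡ y
    head-at-y e∋z e∌x tail≡z with incident-tail-or-head G ψ (end-at-y e∋z e∌x)
    ... | inj₁ t≡y = ⊥-elim (y≢z (trans (sym t≡y) tail≡z))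
    ... | inj₂ h≡y = h≡y

    few-free-edges-extend : F ≤ 1 → Tall G β z x ψ → Tame G β z x ψ → Extends G β z ψ
    few-free-edges-extend few tall tame with squeeze few tall tame
    ... | Zy≡3 , F≡1 , τ≡0
      with proj₂ tall (z-excess Zy≡3 F≡1) | count-exists {f = free} (ℕP.≤-reflexive (sym F≡1))
    ... | e₁ , e₂ , e₁∋z , e₁∌x , head≡z , e₂∋z , e₂∌x , tail≡z | f , free-f
      with steer-one G loopless ψ (deg-y≡4 Zy≡3 F≡1) (∧-true-left free-f)
             (free⇒¬z e₁∋z free-f) (free⇒¬z e₂∋z free-f)
             (tail-at-y e₁∋z e₁∌x head≡z) (head-at-y e₂∋z e₂∌x tail≡z)
    ... | o , off , y-balanced = extends-if-y-valid o (λ e e∋z → off e (free⇒¬z e∋z free-f))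
      (subst (_≡₃ β y) (sym y-balanced)
        (≡₃-sym {β y} {+ 0} (τ≡0⇒β≡₃0 G β y (cong (_% 2) (deg-y≡4 Zy≡3 F≡1)) τ≡0)))

  three-vertices-extend : Tall G β z x ψ → Tame G β z x ψ → Extends G β z ψ
  three-vertices-extend tall tame with count free ℕP.≤? 1
  ... | yes few  = few-free-edges-extend few tall tame
  ... | no many with count-two (ℕP.≰⇒> many)
  ...   | f₁ , f₂ , f₁≢f₂ , free₁ , free₂ = two-free-edges-extend f₁≢f₂ free₁ free₂

module _ {n m : ℕ} {G : Graph n m} (loopless : Loopless G) {β : Fin n → ℤ} (boundary : IsBoundary G β)
         {z x : Fin n} {ψ : Fin m → Bool} (preflow : IsTipPreflow G β z ψ) (x≢z : x ≢ z) where

  three-vertices-besides-tip : Tall G β z x ψ → Tame G β z x ψ → ¬ Extends G β z ψ →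
    ThreeDistinct (λ v → v ≢ z)
  three-vertices-besides-tip tall tame ¬extends with any? (λ y → ¬? (y ≟ z) ×-dec ¬? (y ≟ x))
  ... | no only-z-x = ⊥-elim (¬extends
        (extends-from-all-but-one loopless boundary preflow ψ x (λ _ _ → refl)
          (λ v v≢x v≢z → ⊥-elim (only-z-x (v , v≢z , v≢x)))))
  ... | yes (y , y≢z , y≢x) with any? (λ w → ¬? (w ≟ z) ×-dec ¬? (w ≟ x) ×-dec ¬? (w ≟ y))
  ...   | no only-z-x-y = ⊥-elim (¬extends
          (three-vertices-extend loopless boundary preflow x≢z y≢z y≢x
            (covered-by-three only-z-x-y) tall tame))
  ...   | yes (w , w≢z , w≢x , w≢y) = x , y , w , x≢z , y≢z , w≢z , y≢x ∘ sym , w≢x ∘ sym , w≢y ∘ sym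

mainTheorem16 : ∀ {n m : ℕ} (G : Graph n m) (β : Fin n → ℤ) (z x : Fin n) (ψ : Fin m → Bool) →
    Loopless G → IsBoundary G β → x ≢ z → IsTipPreflow G β z ψ →
    Tall G β z x ψ → Tame G β z x ψ → IsCritical G β z ψ →
    TwoConnectedOn G (λ v → v ≢ z)
mainTheorem16 G β z x ψ loopless boundary x≢z preflow tall tame (¬extends , quotients) =
  three , unseparated⇒connected no-separation three , unseparated⇒connected-avoiding no-separation
  where
  three : ThreeDistinct (λ v → v ≢ z)
  three = three-vertices-besides-tip loopless boundary preflow x≢z tall tame ¬extends
  no-separation : ∀ {c} → c ≢ z → ¬ Separation G z c
  no-separation c≢z = ¬extends ∘ separation-extends loopless boundary preflow quotients c≢z
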